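{- Let $f$ be the $n$-ary operation on $\mathbb{Z}_8$ given by $f=2x_1\cdots x_n\left(\sum_{i=1}^n a_ix_i^2+\sum_{i=1}^n b_ix_i+c\right)$ with $a_i,b_i\in\{0,1\}$, $c\in\{0,1,2,3\}$. (i) If $a_i=1$ for some $i$, then $4r_k\in C(f)$ for every $1\le k\le n+2$. (ii) If $b_i=1$ for some $i$, then $4r_k\in C(f)$ for every $1\le k\le n+1$.
   Context: For an operation $g$ on $\mathbb{Z}_8$, $C(g)$ denotes the clone on $\mathbb{Z}_8$ generated by $g$, the binary addition and all unary constant operations. $r_k=x_1x_2\cdots x_k$, and $4r_k$ is the operation $4x_1\cdots x_k$ modulo 8. -}

module Defs where

open import Data.Nat using (ℕ; zero; suc; _+_; _*_)
open import Data.Nat.DivMod using (_mod_)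
open import Data.Fin using (Fin; toℕ) renaming (zero to fzero; suc to fsuc)
open import Relation.Binary.PropositionalEquality using (_≡_)

Z8 : Set
Z8 = Fin 8

Op : ℕ → Set
Op m = (Fin m → Z8) → Z8

[_]₈ : ℕ → Z8
[ k ]₈ = k mod 8

ΣF : ∀ {n} → (Fin n → ℕ) → ℕ
ΣF {zero}  f = 0
ΣF {suc n} f = f fzero + ΣF (λ i → f (fsuc i))

ΠF : ∀ {n} → (Fin n → ℕ) → ℕ
ΠF {zero}  f = 1
ΠF {suc n} f = f fzero * ΠF (λ i → f (fsuc i))

add₈ : Op 2
add₈ x = [ toℕ (x fzero) + toℕ (x (fsuc fzero)) ]₈

4r : (k : ℕ) → Op k
4r k x = [ 4 * ΠF (λ i → toℕ (x i)) ]₈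

fOp : (n : ℕ) → (a b : Fin n → Fin 2) → Fin 4 → Op n
fOp n a b c x =
  [ 2 * ΠF (λ i → toℕ (x i))
      * ( ΣF (λ i → toℕ (a i) * (toℕ (x i) * toℕ (x i)))
        + ΣF (λ i → toℕ (b i) * toℕ (x i))
        + toℕ c) ]₈

-- C(g): the clone on ℤ₈ generated by the m-ary operation g, the binary
-- addition and all unary constant operations, i.e. the smallest set of
-- finitary operations containing these and all projections and closed
-- under composition (operations compared extensionally).
data C {n : ℕ} (g : Op n) : ∀ {m} → Op m → Set where
  proj  : ∀ {m} (i : Fin m) → C g {m} (λ x → x i)
  gen   : C g {n} g
  plus  : C g {2} add₈
  const : (e : Z8) → C g {1} (λ _ → e)
  comp  : ∀ {k m} {h : Op k} (hs : Fin k → Op m) →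
          C g h → (∀ j → C g (hs j)) → C g {m} (λ x → h (λ j → hs j x))
  ext   : ∀ {m} {h h' : Op m} → (∀ x → h x ≡ h' x) → C g h → C g h'

{-# OPTIONS --safe #-}
-- Fix i with aᵢ = 1 (for (ii): bᵢ = 1 and aᵢ = 0, as otherwise (i) applies). In xᵢ
-- alone, f is the polynomial t ↦ 2Qt(aᵢt² + bᵢt + E), Q being the product of the other
-- arguments. Since the clone contains addition, and 7 acts as -1, it contains the third
-- (resp. second) finite difference of f in xᵢ along fresh variables u, v, w (resp. u, v).
-- The lower-degree parts cancel and what remains is 2·6·uvwQ ≡ 4uvwQ (resp. 2·2·uvQ),
-- i.e. 4r_{n+2} (resp. 4r_{n+1}). Substituting the constant 1 for variables gives the
-- smaller k.

module Submission where

open import Defs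
open import Data.Nat using (ℕ; zero; suc; _+_; _*_; _%_; _≤_; s≤s; _≤′_; ≤′-refl; ≤′-step)
open import Data.Nat.Properties
  using (+-comm; +-identityʳ; ≤⇒≤′; +-commutativeSemigroup; *-commutativeSemigroup)
open import Data.Nat.DivMod using (%-distribˡ-+; %-distribˡ-*; m%n%n≡m%n; [m+kn]%n≡m%n; m<n⇒m%n≡m; m%n<n)
open import Data.Nat.Solver using (module +-*-Solver)
open import Data.Nat.Tactic.RingSolver using (solve-∀)
open import Data.Fin using (Fin; toℕ; punchIn; raise) renaming (zero to fzero; suc to fsuc)
open import Data.Fin.Patterns using (0F; 1F; 2F)
open import Data.Fin.Properties using (toℕ-injective; toℕ-fromℕ<; toℕ<n)
open import Data.Vec.Functional using (insertAt; _∷_; [])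
open import Algebra.Properties.CommutativeSemigroup using (x∙yz≈y∙xz)
open import Data.Product using (_×_; ∃; _,_)
open import Function using (_∘_; id)
open import Relation.Binary.PropositionalEquality using (_≡_; refl; sym; trans; cong; cong₂; subst; module ≡-Reasoning)

infix 4 _≡₈_
record _≡₈_ (x y : ℕ) : Set where
  constructor mod₈
  field %8-≡ : x % 8 ≡ y % 8

≡₈-refl : ∀ {x} → x ≡₈ x
≡₈-refl = mod₈ refl

≡₈-sym : ∀ {x y} → x ≡₈ y → y ≡₈ x
≡₈-sym (mod₈ p) = mod₈ (sym p)

≡₈-trans : ∀ {x y z} → x ≡₈ y → y ≡₈ z → x ≡₈ z
≡₈-trans (mod₈ p) (mod₈ q) = mod₈ (trans p q)

≡⇒≡₈ : ∀ {x y} → x ≡ y → x ≡₈ y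
≡⇒≡₈ p = mod₈ (cong (_% 8) p)

+-cong₈ : ∀ {x x′ y y′} → x ≡₈ x′ → y ≡₈ y′ → x + y ≡₈ x′ + y′
+-cong₈ {x} {x′} {y} {y′} (mod₈ p) (mod₈ q) = mod₈ (begin
  (x + y) % 8                ≡⟨ %-distribˡ-+ x y 8 ⟩
  (x % 8 + y % 8) % 8        ≡⟨ cong₂ (λ s t → (s + t) % 8) p q ⟩
  (x′ % 8 + y′ % 8) % 8      ≡⟨ %-distribˡ-+ x′ y′ 8 ⟨
  (x′ + y′) % 8              ∎)
  where open ≡-Reasoning

*-cong₈ : ∀ {x x′ y y′} → x ≡₈ x′ → y ≡₈ y′ → x * y ≡₈ x′ * y′
*-cong₈ {x} {x′} {y} {y′} (mod₈ p) (mod₈ q) = mod₈ (begin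
  (x * y) % 8                ≡⟨ %-distribˡ-* x y 8 ⟩
  (x % 8 * (y % 8)) % 8      ≡⟨ cong₂ (λ s t → (s * t) % 8) p q ⟩
  (x′ % 8 * (y′ % 8)) % 8    ≡⟨ %-distribˡ-* x′ y′ 8 ⟨
  (x′ * y′) % 8              ∎)
  where open ≡-Reasoning

+-*8-≡₈ : ∀ x k → x + k * 8 ≡₈ x
+-*8-≡₈ x k = mod₈ ([m+kn]%n≡m%n x k 8)

toℕ-[]₈ : ∀ x → toℕ [ x ]₈ ≡₈ x
toℕ-[]₈ x = mod₈ (trans (cong (_% 8) (toℕ-fromℕ< (m%n<n x 8))) (m%n%n≡m%n x 8))

toℕ-injective₈ : {e e′ : Z8} → toℕ e ≡₈ toℕ e′ → e ≡ e′
toℕ-injective₈ {e} {e′} (mod₈ p) =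
  toℕ-injective (trans (sym (m<n⇒m%n≡m (toℕ<n e))) (trans p (m<n⇒m%n≡m (toℕ<n e′))))

toℕ-4r : ∀ {m} (y : Fin m → Z8) → 4 * ΠF (toℕ ∘ y) ≡₈ toℕ (4r m y)
toℕ-4r y = ≡₈-sym (toℕ-[]₈ (4 * ΠF (toℕ ∘ y)))

-- 7 ≡ -1 (mod 8), so this is the subtraction of A from X.
difference₈ : ∀ {X} A Y → X ≡ A + Y → X + 7 * A ≡₈ Y
difference₈ A Y refl = ≡₈-trans (≡⇒≡₈ (regroup A Y)) (+-*8-≡₈ Y A)
  where
  regroup : ∀ A Y → A + Y + 7 * A ≡ Y + A * 8
  regroup = solve-∀

12*≡₈4* : ∀ x → 12 * x ≡₈ 4 * x
12*≡₈4* x = ≡₈-trans (≡⇒≡₈ (split x)) (+-*8-≡₈ (4 * x) x)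
  where
  split : ∀ x → 12 * x ≡ 4 * x + x * 8
  split = solve-∀

ΣF-insertAt : ∀ {n} {A : Set} (w : Fin (suc n) → A → ℕ) (xs : Fin n → A) (i : Fin (suc n)) (t : A) →
              ΣF (λ j → w j (insertAt xs i t j)) ≡ w i t + ΣF (λ j → w (punchIn i j) (xs j))
ΣF-insertAt         w xs fzero    t = refl
ΣF-insertAt {suc n} w xs (fsuc i) t =
  trans (cong (w fzero (xs fzero) +_) (ΣF-insertAt (w ∘ fsuc) (xs ∘ fsuc) i t))
        (x∙yz≈y∙xz +-commutativeSemigroup (w fzero (xs fzero)) (w (fsuc i) t) _)

ΠF-insertAt : ∀ {n} {A : Set} (w : Fin (suc n) → A → ℕ) (xs : Fin n → A) (i : Fin (suc n)) (t : A) →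
              ΠF (λ j → w j (insertAt xs i t j)) ≡ w i t * ΠF (λ j → w (punchIn i j) (xs j))
ΠF-insertAt         w xs fzero    t = refl
ΠF-insertAt {suc n} w xs (fsuc i) t =
  trans (cong (w fzero (xs fzero) *_) (ΠF-insertAt (w ∘ fsuc) (xs ∘ fsuc) i t))
        (x∙yz≈y∙xz *-commutativeSemigroup (w fzero (xs fzero)) (w (fsuc i) t) _)

module _ {n} {g : Op n} where

  const-∈C : ∀ {m} (e : Z8) → C g {suc m} (λ _ → e)
  const-∈C e = comp (λ _ x → x fzero) (const e) (λ _ → proj fzero)

  insertAt-∈C : ∀ {k m} {hs : Fin k → Op m} {h : Op m} → (∀ j → C g (hs j)) → C g h →
                ∀ i j → C g (λ x → insertAt (λ l → hs l x) i (h x) j)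
  insertAt-∈C             hs∈C h∈C fzero    fzero    = h∈C
  insertAt-∈C             hs∈C h∈C fzero    (fsuc j) = hs∈C j
  insertAt-∈C {k = suc k} hs∈C h∈C (fsuc i) fzero    = hs∈C fzero
  insertAt-∈C {k = suc k} hs∈C h∈C (fsuc i) (fsuc j) = insertAt-∈C (hs∈C ∘ fsuc) h∈C i j

  4r-drop : ∀ {m} → C g (4r (2 + m)) → C g (4r (1 + m))
  4r-drop {m} 4r∈C = ext one-first (comp args 4r∈C args∈C)
    where
    args : Fin (2 + m) → Op (1 + m)
    args = (λ _ → 1F) ∷ (λ j x → x j)
    args∈C : ∀ j → C g (args j)
    args∈C fzero    = const-∈C 1F
    args∈C (fsuc j) = proj j
    one-first : ∀ x → 4r (2 + m) (λ j → args j x) ≡ 4r (1 + m) x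
    one-first x = cong (λ p → [ 4 * p ]₈) (+-identityʳ (ΠF (toℕ ∘ x)))

  4r-antitone′ : ∀ {k m} → k ≤′ m → C g (4r (suc m)) → C g (4r (suc k))
  4r-antitone′ ≤′-refl       = id
  4r-antitone′ (≤′-step k≤m) = 4r-antitone′ k≤m ∘ 4r-drop

  4r-antitone : ∀ {k m} → 1 ≤ k → k ≤ m → C g (4r m) → C g (4r k)
  4r-antitone (s≤s _) (s≤s k≤m) = 4r-antitone′ (≤⇒≤′ k≤m)

-- Members of C(g) are tracked through ℕ-valued expressions they compute modulo 8, so
-- that the algebra happens in ℕ, where the ring solver applies.
record Realises {n m} (g : Op n) (N : (Fin m → Z8) → ℕ) : Set where
  field
    op     : Op m
    op∈C   : C g op
    toℕ-op : ∀ x → toℕ (op x) ≡₈ N x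
open Realises

module _ {n} {g : Op n} where

  proj-realises : ∀ {m} (i : Fin m) → Realises g (λ x → toℕ (x i))
  proj-realises i = record { op = λ x → x i ; op∈C = proj i ; toℕ-op = λ _ → ≡₈-refl }

  infixl 6 _⊕_ _⊖_

  _⊕_ : ∀ {m} {M N : (Fin m → Z8) → ℕ} → Realises g M → Realises g N → Realises g (λ x → M x + N x)
  _⊕_ {m} r s = record
    { op     = λ x → add₈ (λ j → summands j x)
    ; op∈C   = comp summands plus λ { 0F → op∈C r ; 1F → op∈C s }
    ; toℕ-op = λ x → ≡₈-trans (toℕ-[]₈ _) (+-cong₈ (toℕ-op r x) (toℕ-op s x))
    }
    where
    summands : Fin 2 → Op m
    summands = op r ∷ op s ∷ []

  suc-*-realises : ∀ {m} {N : (Fin m → Z8) → ℕ} k → Realises g N → Realises g (λ x → suc k * N x)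
  suc-*-realises zero    r = record
    { op     = op r
    ; op∈C   = op∈C r
    ; toℕ-op = λ x → ≡₈-trans (toℕ-op r x) (≡⇒≡₈ (sym (+-identityʳ _)))
    }
  suc-*-realises (suc k) r = r ⊕ suc-*-realises k r

  _⊖_ : ∀ {m} {M N : (Fin m → Z8) → ℕ} → Realises g M → Realises g N → Realises g (λ x → M x + 7 * N x)
  r ⊖ s = r ⊕ suc-*-realises 6 s

  realises⇒∈C : ∀ {m} {N : (Fin m → Z8) → ℕ} {h : Op m} → Realises g N → (∀ x → N x ≡₈ toℕ (h x)) → C g h
  realises⇒∈C r N≡₈h = ext (λ x → toℕ-injective₈ (≡₈-trans (toℕ-op r x) (N≡₈h x))) (op∈C r)

-- f as a function of xᵢ = t alone: Q is the product of the other arguments and E the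
-- part of Σ aⱼxⱼ² + Σ bⱼxⱼ + c not involving xᵢ.
slice : (α β Q E t : ℕ) → ℕ
slice α β Q E t = 2 * (t * Q) * (α * (t * t) + β * t + E)

slice-cong₈ : ∀ α β Q E {t t′} → t ≡₈ t′ → slice α β Q E t ≡₈ slice α β Q E t′
slice-cong₈ α β Q E t≡t′ =
  *-cong₈ (*-cong₈ (≡₈-refl {2}) (*-cong₈ t≡t′ (≡₈-refl {Q})))
          (+-cong₈ (+-cong₈ (*-cong₈ (≡₈-refl {α}) (*-cong₈ t≡t′ t≡t′)) (*-cong₈ (≡₈-refl {β}) t≡t′)) (≡₈-refl {E}))

slice-third-difference₈ : ∀ {α} → α ≡ 1 → ∀ β Q E u v w → let s = slice α β Q E in
  s (u + v + w) + s u + s v + s w + 7 * (s (u + v) + s (u + w) + s (v + w)) ≡₈ 4 * (u * (v * (w * Q)))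
slice-third-difference₈ refl β Q E u v w =
  ≡₈-trans (difference₈ (s (u + v) + s (u + w) + s (v + w)) (12 * P) exact) (12*≡₈4* P)
  where
  open +-*-Solver
  s : ℕ → ℕ
  s = slice 1 β Q E
  P : ℕ
  P = u * (v * (w * Q))
  exact : s (u + v + w) + s u + s v + s w ≡ s (u + v) + s (u + w) + s (v + w) + 12 * P
  exact = solve 6 (λ β Q E u v w →
    let s = λ t → con 2 :* (t :* Q) :* (con 1 :* (t :* t) :+ β :* t :+ E) in
    s (u :+ v :+ w) :+ s u :+ s v :+ s w := s (u :+ v) :+ s (u :+ w) :+ s (v :+ w) :+ con 12 :* (u :* (v :* (w :* Q))))
    refl β Q E u v w

slice-second-difference₈ : ∀ {α β} → α ≡ 0 → β ≡ 1 → ∀ Q E u v → let s = slice α β Q E in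
  s (u + v) + 7 * (s u + s v) ≡₈ 4 * (u * (v * Q))
slice-second-difference₈ refl refl Q E u v = difference₈ (s u + s v) (4 * (u * (v * Q))) exact
  where
  open +-*-Solver
  s : ℕ → ℕ
  s = slice 0 1 Q E
  exact : s (u + v) ≡ s u + s v + 4 * (u * (v * Q))
  exact = solve 4 (λ Q E u v →
    let s = λ t → con 2 :* (t :* Q) :* (con 0 :* (t :* t) :+ con 1 :* t :+ E) in
    s (u :+ v) := s u :+ s v :+ con 4 :* (u :* (v :* Q)))
    refl Q E u v

module _ {n} (a b : Fin (suc n) → Fin 2) (c : Fin 4) (i : Fin (suc n)) where

  othersSum : (Fin n → Z8) → ℕ
  othersSum xs = ΣF (λ j → toℕ (a (punchIn i j)) * (toℕ (xs j) * toℕ (xs j)))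
               + ΣF (λ j → toℕ (b (punchIn i j)) * toℕ (xs j)) + toℕ c

  fOp-insertAt : ∀ xs t → toℕ (fOp (suc n) a b c (insertAt xs i t))
                          ≡₈ slice (toℕ (a i)) (toℕ (b i)) (ΠF (toℕ ∘ xs)) (othersSum xs) (toℕ t)
  fOp-insertAt xs t = ≡₈-trans (toℕ-[]₈ _) (≡⇒≡₈ (begin
      2 * ΠF (toℕ ∘ x) * (ΣF (λ j → toℕ (a j) * (toℕ (x j) * toℕ (x j))) + ΣF (λ j → toℕ (b j) * toℕ (x j)) + c′)
    ≡⟨ cong₂ (λ p s → 2 * p * (s + c′))
             (ΠF-insertAt (λ _ → toℕ) xs i t)
             (cong₂ _+_ (ΣF-insertAt (λ j y → toℕ (a j) * (toℕ y * toℕ y)) xs i t)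
                        (ΣF-insertAt (λ j y → toℕ (b j) * toℕ y) xs i t)) ⟩
      2 * (T * Q) * (α * (T * T) + A′ + (β * T + B′) + c′)
    ≡⟨ cong (2 * (T * Q) *_) (regroup (α * (T * T)) A′ (β * T) B′ c′) ⟩
      slice α β Q (A′ + B′ + c′) T
    ∎))
    where
    open ≡-Reasoning
    x : Fin (suc n) → Z8
    x = insertAt xs i t
    T α β c′ Q A′ B′ : ℕ
    T = toℕ t
    α = toℕ (a i)
    β = toℕ (b i)
    c′ = toℕ c
    Q = ΠF (toℕ ∘ xs)
    A′ = ΣF (λ j → toℕ (a (punchIn i j)) * (toℕ (xs j) * toℕ (xs j)))
    B′ = ΣF (λ j → toℕ (b (punchIn i j)) * toℕ (xs j))
    regroup : ∀ s s′ r r′ c → s + s′ + (r + r′) + c ≡ s + r + (s′ + r′ + c)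
    regroup = solve-∀

  sliceAt : ∀ {m} → (Fin n → Fin m) → ((Fin m → Z8) → ℕ) → (Fin m → Z8) → ℕ
  sliceAt ρ T y = slice (toℕ (a i)) (toℕ (b i)) (ΠF (toℕ ∘ y ∘ ρ)) (othersSum (y ∘ ρ)) (T y)

  fOp-realises : ∀ {m} {T : (Fin m → Z8) → ℕ} (ρ : Fin n → Fin m) →
                 Realises (fOp (suc n) a b c) T → Realises (fOp (suc n) a b c) (sliceAt ρ T)
  fOp-realises ρ r = record
    { op     = λ y → fOp (suc n) a b c (insertAt (y ∘ ρ) i (op r y))
    ; op∈C   = comp (λ j y → insertAt (y ∘ ρ) i (op r y) j) gen (insertAt-∈C (proj ∘ ρ) (op∈C r) i)
    ; toℕ-op = λ y → ≡₈-trans (fOp-insertAt (y ∘ ρ) (op r y))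
                              (slice-cong₈ (toℕ (a i)) (toℕ (b i)) (ΠF (toℕ ∘ y ∘ ρ)) (othersSum (y ∘ ρ)) (toℕ-op r y))
    }

-- Arguments of arity d + n: the d fresh variables come first, the other n fill the
-- coordinates of f other than i.
module FreshVariables {n} (a b : Fin (suc n) → Fin 2) (c : Fin 4) (i : Fin (suc n)) (d : ℕ) where

  f : Op (suc n)
  f = fOp (suc n) a b c

  G : ∀ {T} → Realises f T → Realises f (sliceAt a b c i (raise d) T)
  G = fOp-realises a b c i (raise d)

  x : (k : Fin (d + n)) → Realises f (λ y → toℕ (y k))
  x = proj-realises

  Q E : (Fin (d + n) → Z8) → ℕ
  Q y = ΠF (toℕ ∘ y ∘ raise d)
  E y = othersSum a b c i (y ∘ raise d)

cubic⇒4r[2+n]∈C : ∀ {n} (a b : Fin n → Fin 2) (c : Fin 4) (i : Fin n) → a i ≡ 1F → C (fOp n a b c) (4r (2 + n))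
cubic⇒4r[2+n]∈C {suc n} a b c i aᵢ≡1 =
  realises⇒∈C (G (x 0F ⊕ x 1F ⊕ x 2F) ⊕ G (x 0F) ⊕ G (x 1F) ⊕ G (x 2F)
                ⊖ (G (x 0F ⊕ x 1F) ⊕ G (x 0F ⊕ x 2F) ⊕ G (x 1F ⊕ x 2F)))
    λ y → ≡₈-trans (slice-third-difference₈ (cong toℕ aᵢ≡1) (toℕ (b i)) (Q y) (E y)
                                            (toℕ (y 0F)) (toℕ (y 1F)) (toℕ (y 2F)))
                   (toℕ-4r y)
  where open FreshVariables a b c i 3

quadratic⇒4r[1+n]∈C : ∀ {n} (a b : Fin n → Fin 2) (c : Fin 4) (i : Fin n) → a i ≡ 0F → b i ≡ 1F →
                      C (fOp n a b c) (4r (1 + n))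
quadratic⇒4r[1+n]∈C {suc n} a b c i aᵢ≡0 bᵢ≡1 =
  realises⇒∈C (G (x 0F ⊕ x 1F) ⊖ (G (x 0F) ⊕ G (x 1F)))
    λ y → ≡₈-trans (slice-second-difference₈ (cong toℕ aᵢ≡0) (cong toℕ bᵢ≡1) (Q y) (E y) (toℕ (y 0F)) (toℕ (y 1F)))
                   (toℕ-4r y)
  where open FreshVariables a b c i 2

linear⇒4r[1+n]∈C : ∀ {n} (a b : Fin n → Fin 2) (c : Fin 4) (i : Fin n) → b i ≡ 1F → C (fOp n a b c) (4r (1 + n))
linear⇒4r[1+n]∈C a b c i bᵢ≡1 with a i in aᵢ≡
... | 0F = quadratic⇒4r[1+n]∈C a b c i aᵢ≡ bᵢ≡1
... | 1F = 4r-drop (cubic⇒4r[2+n]∈C a b c i aᵢ≡)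

lemma4p1 : (n : ℕ) (a b : Fin n → Fin 2) (c : Fin 4) →
    ((∃ λ i → a i ≡ fsuc fzero) → (k : ℕ) → 1 ≤ k → k ≤ n + 2 → C (fOp n a b c) (4r k))
    × ((∃ λ i → b i ≡ fsuc fzero) → (k : ℕ) → 1 ≤ k → k ≤ n + 1 → C (fOp n a b c) (4r k))
lemma4p1 n a b c =
    (λ { (i , aᵢ≡1) k 1≤k k≤n+2 →
           4r-antitone 1≤k (subst (k ≤_) (+-comm n 2) k≤n+2) (cubic⇒4r[2+n]∈C a b c i aᵢ≡1) })
  , (λ { (i , bᵢ≡1) k 1≤k k≤n+1 →
           4r-antitone 1≤k (subst (k ≤_) (+-comm n 1) k≤n+1) (linear⇒4r[1+n]∈C a b c i bᵢ≡1) })
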